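{- Let $n$ be a Carmichael number whose index $i(n)=\frac{n-1}{\lambda(n)}$ is even. Then exactly $\frac12\varphi(n)$ elements of $\mathbb{Z}_n^*$ are Euler liars for $n$, and every Euler liar $a$ satisfies $\left(\frac{a}{n}\right)=1$.
   Context: A Carmichael number is a composite integer $n$ such that $a^{n-1}\equiv 1 \pmod n$ for all $a$ coprime to $n$; such $n$ is odd and squarefree. $\lambda(n)$ denotes the Carmichael lambda function: the smallest positive integer $\ell$ with $a^\ell\equiv 1\pmod n$ for all $a\in\mathbb{Z}_n^*$; for squarefree $n=\prod p_i$ it equals $\mathrm{lcm}(p_i-1)$, and for a Carmichael number $\lambda(n)\mid n-1$. The index of a Carmichael number is $i(n)=(n-1)/\lambda(n)$. For an odd composite $n$, an element $a\in\mathbb{Z}_n^*$ is an Euler liar if $\left(\frac{a}{n}\right)\equiv a^{(n-1)/2}\pmod n$, where $\left(\frac{a}{n}\right)$ is the Jacobi symbol. -}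

module Defs where

open import Data.Nat using (ℕ; zero; suc; _+_; _*_; _∸_; _^_; _≤?_; _/_; _<_)
open import Data.Nat.Divisibility using (_∣_; _∣?_)
open import Data.Nat.Coprimality using (Coprime; coprime?)
open import Data.Nat.Primality using (Composite)
open import Data.Integer as ℤ using (ℤ; +_; ∣_∣)
open import Data.List using (List; []; _∷_; filter; length; upTo; map)
open import Data.List.Relation.Unary.Any using (Any; any?)
open import Data.Product using (_×_; Σ)
open import Relation.Nullary using (Dec; yes; no; ¬_)
open import Relation.Nullary.Decidable using (_×-dec_)

_≡_[mod_] : ℤ → ℤ → ℕ → Set
x ≡ y [mod n ] = n ∣ ∣ x ℤ.- y ∣

_≡?_[mod_] : ∀ x y n → Dec (x ≡ y [mod n ])
x ≡? y [mod n ] = n ∣? ∣ x ℤ.- y ∣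

Unit : ℕ → ℕ → Set
Unit n a = a < n × Coprime a n

IsCarmichael : ℕ → Set
IsCarmichael n = Composite n ×
  (∀ a → Coprime a n → (+ (a ^ (n ∸ 1))) ≡ + 1 [mod n ])

IsCarmichaelLambda : ℕ → ℕ → Set
IsCarmichaelLambda n ℓ = 0 < ℓ ×
  (∀ a → Coprime a n → (+ (a ^ ℓ)) ≡ + 1 [mod n ]) ×
  (∀ m → 0 < m → (∀ a → Coprime a n → (+ (a ^ m)) ≡ + 1 [mod n ]) → ℓ Data.Nat.≤ m)

φ : ℕ → ℕ
φ n = length (filter (λ a → coprime? a n) (upTo n))

legendre : ℕ → ℕ → ℤ
legendre a p with p ∣? a
... | yes _ = + 0
... | no _ with any? (λ x → (+ (x * x)) ≡? (+ a) [mod p ]) (upTo p)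
...   | yes _ = + 1
...   | no _ = ℤ.-[1+ 0 ]

-- least divisor of n that is ≥ 2, written as 2 + k (for n ≥ 2 it is prime)
leastDivisorPred : ℕ → ℕ
leastDivisorPred n = first (filter (λ k → (2 + k) ∣? n) (upTo (n ∸ 1)))
  where
  first : List ℕ → ℕ
  first []      = n ∸ 2
  first (k ∷ _) = k

-- Computed by repeatedly
-- splitting off the least prime factor; the fuel argument (initially n)
-- is always sufficient since the cofactor at least halves each step.
jacobiFuel : ℕ → ℕ → ℕ → ℤ
jacobiFuel zero    a n = + 1
jacobiFuel (suc f) a n with n ≤? 1
... | yes _ = + 1
... | no _  = legendre a (2 + leastDivisorPred n)
               ℤ.* jacobiFuel f a (n / (2 + leastDivisorPred n))

jacobi : ℕ → ℕ → ℤ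
jacobi a n = jacobiFuel n a n

IsEulerLiar : ℕ → ℕ → Set
IsEulerLiar n a = Unit n a × jacobi a n ≡ (+ (a ^ ((n ∸ 1) / 2))) [mod n ]

isEulerLiar? : ∀ n a → Dec (IsEulerLiar n a)
isEulerLiar? n a = ((a Data.Nat.<? n) ×-dec coprime? a n)
  ×-dec (jacobi a n ≡? (+ (a ^ ((n ∸ 1) / 2))) [mod n ])

eulerLiars : ℕ → List ℕ
eulerLiars n = filter (isEulerLiar? n) (upTo n)

-- Since i(n) is even, λ(n) divides (n − 1)/2, so a^((n−1)/2) ≡ 1 for every unit a; as n > 2, the
-- Euler liars are then exactly the units of Jacobi symbol +1.  These are half of all units: for the
-- least prime factor q of n, Korselt's argument gives q² ∤ n, so by the Chinese remainder theorem
-- there is a unit b ≡ c (mod q), b ≡ 1 (mod n/q) with c a quadratic nonresidue mod q, and a ↦ b a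
-- swaps the units of symbol +1 and −1.  That c exists and negates the Legendre symbol mod q because
-- exactly half of the nonzero residues mod q are squares.
module Submission where

open import Defs
open import Data.Nat using (ℕ; zero; suc; _+_; _*_; _∸_; _^_; _/_; _%_; _≤_; _<_; _≤?_; _<?_;
  _≟_; z≤n; s≤s; z<s; s<s; NonZero; >-nonZero; >-nonZero⁻¹; ≢-nonZero⁻¹; nonTrivial⇒n>1)
open import Data.Nat.Properties
open import Data.Nat.DivMod
open import Data.Nat.Divisibility
open import Data.Nat.Coprimality as Coprimality using (Coprime; coprime?; coprime-divisor; 1-coprimeTo)
open import Data.Nat.GCD using (module Bézout)
open import Data.Nat.Primality using (Prime; _Rough_; euclidsLemma; prime⇒nonZero;
  prime⇒nonTrivial; prime⇒irreducible; composite⇒¬prime; rough∧∣⇒prime)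
open import Data.Nat.Induction using (<-rec)
open import Data.Nat.Tactic.RingSolver using (solve-∀)
open import Data.Integer as ℤ using (ℤ; +_; -[1+_]; ∣_∣)
import Data.Integer.Properties as ℤ
open import Data.List using ([]; _∷_; length; filter; upTo; applyUpTo)
open import Data.List.Properties using (filter-some)
open import Data.List.Relation.Unary.Any using (Any; any?)
import Data.List.Relation.Unary.Any.Properties as Any
open import Data.Product using (_×_; _,_; proj₁; proj₂; ∃-syntax)
open import Data.Sum using (_⊎_; inj₁; inj₂; [_,_]′)
open import Function using (_∘_; id)
open import Relation.Nullary using (Dec; yes; no; ¬_; contradiction)
open import Relation.Nullary.Decidable using (map′; _×-dec_; ¬?; _→-dec_)
open import Relation.Unary using (Decidable)
open import Relation.Binary.PropositionalEquality

private variable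
  P Q R : ℕ → Set

sumBelow : ℕ → (ℕ → ℕ) → ℕ
sumBelow zero    f = 0
sumBelow (suc n) f = f 0 + sumBelow n (f ∘ suc)

sumBelow-cong : ∀ n {f g} → (∀ a → a < n → f a ≡ g a) → sumBelow n f ≡ sumBelow n g
sumBelow-cong zero    e = refl
sumBelow-cong (suc n) e = cong₂ _+_ (e 0 z<s) (sumBelow-cong n (λ a a<n → e (suc a) (s<s a<n)))

sumBelow-+ : ∀ n f g → sumBelow n (λ a → f a + g a) ≡ sumBelow n f + sumBelow n g
sumBelow-+ zero    f g = refl
sumBelow-+ (suc n) f g = begin
  f 0 + g 0 + sumBelow n (λ a → f (suc a) + g (suc a))
    ≡⟨ cong (λ s → f 0 + g 0 + s) (sumBelow-+ n (f ∘ suc) (g ∘ suc)) ⟩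
  f 0 + g 0 + (sumBelow n (f ∘ suc) + sumBelow n (g ∘ suc))
    ≡⟨ interchange (f 0) (g 0) _ _ ⟩
  f 0 + sumBelow n (f ∘ suc) + (g 0 + sumBelow n (g ∘ suc)) ∎
  where
  open ≡-Reasoning
  interchange : ∀ a b c d → a + b + (c + d) ≡ a + c + (b + d)
  interchange = solve-∀

sumBelow-zero : ∀ n {f} → (∀ a → a < n → f a ≡ 0) → sumBelow n f ≡ 0
sumBelow-zero zero    e = refl
sumBelow-zero (suc n) e = cong₂ _+_ (e 0 z<s) (sumBelow-zero n (λ a a<n → e (suc a) (s<s a<n)))

sumBelow-swap : ∀ n k (h : ℕ → ℕ → ℕ) →
  sumBelow n (λ a → sumBelow k (h a)) ≡ sumBelow k (λ b → sumBelow n (λ a → h a b))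
sumBelow-swap zero    k h = sym (sumBelow-zero k (λ _ _ → refl))
sumBelow-swap (suc n) k h = begin
  sumBelow k (h 0) + sumBelow n (λ a → sumBelow k (h (suc a)))
    ≡⟨ cong (λ s → sumBelow k (h 0) + s) (sumBelow-swap n k (h ∘ suc)) ⟩
  sumBelow k (h 0) + sumBelow k (λ b → sumBelow n (λ a → h (suc a) b))
    ≡⟨ sym (sumBelow-+ k (h 0) _) ⟩
  sumBelow k (λ b → sumBelow (suc n) (λ a → h a b)) ∎
  where open ≡-Reasoning

sumBelow-single : ∀ n {f} c {x} → c < n → f c ≡ x → (∀ a → a < n → a ≢ c → f a ≡ 0) →
  sumBelow n f ≡ x
sumBelow-single (suc n) {f} zero {x} _ fc e = begin
  f 0 + sumBelow n (f ∘ suc) ≡⟨ cong₂ _+_ fc (sumBelow-zero n (λ a a<n → e (suc a) (s<s a<n) λ ())) ⟩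
  x + 0                      ≡⟨ +-identityʳ x ⟩
  x                          ∎
  where open ≡-Reasoning
sumBelow-single (suc n) (suc c) (s≤s c<n) fc e = cong₂ _+_ (e 0 z<s λ ())
  (sumBelow-single n c c<n fc (λ a a<n a≢c → e (suc a) (s<s a<n) (a≢c ∘ suc-injective)))

sumBelow-mono-≤ : ∀ n {f g} → (∀ a → a < n → f a ≤ g a) → sumBelow n f ≤ sumBelow n g
sumBelow-mono-≤ zero    le = z≤n
sumBelow-mono-≤ (suc n) le = +-mono-≤ (le 0 z<s) (sumBelow-mono-≤ n (λ a a<n → le (suc a) (s<s a<n)))

sumBelow-mono-< : ∀ n {f g} c → c < n → (∀ a → a < n → f a ≤ g a) → f c < g c →
  sumBelow n f < sumBelow n g
sumBelow-mono-< (suc n) zero    _         le lt =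
  +-mono-<-≤ lt (sumBelow-mono-≤ n (λ a a<n → le (suc a) (s<s a<n)))
sumBelow-mono-< (suc n) (suc c) (s≤s c<n) le lt =
  +-mono-≤-< (le 0 z<s) (sumBelow-mono-< n c c<n (λ a a<n → le (suc a) (s<s a<n)) lt)

𝟙 : {A : Set} → Dec A → ℕ
𝟙 (yes _) = 1
𝟙 (no _)  = 0

𝟙-yes : {A : Set} (d : Dec A) → A → 𝟙 d ≡ 1
𝟙-yes (yes _) _ = refl
𝟙-yes (no ¬a) a = contradiction a ¬a

𝟙-no : {A : Set} (d : Dec A) → ¬ A → 𝟙 d ≡ 0
𝟙-no (yes a) ¬a = contradiction a ¬a
𝟙-no (no _)  _  = refl

count : ℕ → Decidable P → ℕ
count n P? = sumBelow n (𝟙 ∘ P?)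

length-filter-applyUpTo : (P? : Decidable P) → ∀ n f →
  length (filter P? (applyUpTo f n)) ≡ sumBelow n (𝟙 ∘ P? ∘ f)
length-filter-applyUpTo P? zero    f = refl
length-filter-applyUpTo P? (suc n) f with P? (f 0)
... | yes _ = cong suc (length-filter-applyUpTo P? n (f ∘ suc))
... | no _  = length-filter-applyUpTo P? n (f ∘ suc)

length-filter-upTo : (P? : Decidable P) → ∀ n → length (filter P? (upTo n)) ≡ count n P?
length-filter-upTo P? n = length-filter-applyUpTo P? n id

count-positive : ∀ k → count (suc k) (0 <?_) ≡ k
count-positive zero    = refl
count-positive (suc k) = cong suc (count-positive k)

_⊆_below_ : (ℕ → Set) → (ℕ → Set) → ℕ → Set
P ⊆ Q below n = ∀ a → a < n → P a → Q a

𝟙-mono : ∀ {n} (P? : Decidable P) (Q? : Decidable Q) → P ⊆ Q below n →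
  ∀ a → a < n → 𝟙 (P? a) ≤ 𝟙 (Q? a)
𝟙-mono P? Q? P⊆Q a a<n with P? a
... | yes p = ≤-reflexive (sym (𝟙-yes (Q? a) (P⊆Q a a<n p)))
... | no _  = z≤n

count-mono-≤ : ∀ {n} (P? : Decidable P) (Q? : Decidable Q) → P ⊆ Q below n → count n P? ≤ count n Q?
count-mono-≤ {n = n} P? Q? P⊆Q = sumBelow-mono-≤ n (𝟙-mono P? Q? P⊆Q)

count-cong : ∀ {n} (P? : Decidable P) (Q? : Decidable Q) → P ⊆ Q below n → Q ⊆ P below n →
  count n P? ≡ count n Q?
count-cong P? Q? P⊆Q Q⊆P = ≤-antisym (count-mono-≤ P? Q? P⊆Q) (count-mono-≤ Q? P? Q⊆P)

count-mono-< : ∀ {n} (P? : Decidable P) (Q? : Decidable Q) → P ⊆ Q below n →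
  ∀ c → c < n → Q c → ¬ P c → count n P? < count n Q?
count-mono-< {n = n} P? Q? P⊆Q c c<n qc ¬pc = sumBelow-mono-< n c c<n (𝟙-mono P? Q? P⊆Q)
  (subst₂ _<_ (sym (𝟙-no (P? c) ¬pc)) (sym (𝟙-yes (Q? c) qc)) z<s)

count-<⇒∃ : ∀ {P Q : ℕ → Set} {n} (P? : Decidable P) (Q? : Decidable Q) →
  count n P? < count n Q? → ∃[ a ] a < n × Q a × ¬ P a
count-<⇒∃ {P} {Q} {n} P? Q? lt with anyUpTo? (λ a → Q? a ×-dec ¬? (P? a)) n
... | yes witness = witness
... | no none = contradiction lt (≤⇒≯ (count-mono-≤ Q? P? Q⊆P))
  where
  Q⊆P : Q ⊆ P below n
  Q⊆P a a<n qa with P? a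
  ... | yes pa = pa
  ... | no ¬pa = contradiction (a , a<n , qa , ¬pa) none

count-≡⇒⊇ : ∀ {n} (P? : Decidable P) (Q? : Decidable Q) → P ⊆ Q below n →
  count n P? ≡ count n Q? → Q ⊆ P below n
count-≡⇒⊇ P? Q? P⊆Q eq a a<n qa with P? a
... | yes pa = pa
... | no ¬pa = contradiction eq (<⇒≢ (count-mono-< P? Q? P⊆Q a a<n qa ¬pa))

count-partition : ∀ {n} (R? : Decidable R) (P? : Decidable P) (Q? : Decidable Q) →
  (∀ a → a < n → R a → P a ⊎ Q a) → (∀ {a} → P a → R a) → (∀ {a} → Q a → R a) →
  (∀ {a} → P a → ¬ Q a) → count n R? ≡ count n P? + count n Q?
count-partition {n = n} R? P? Q? split P⇒R Q⇒R disjoint =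
  trans (sumBelow-cong n 𝟙-split) (sumBelow-+ n (𝟙 ∘ P?) (𝟙 ∘ Q?))
  where
  𝟙-split : ∀ a → a < n → 𝟙 (R? a) ≡ 𝟙 (P? a) + 𝟙 (Q? a)
  𝟙-split a a<n with R? a
  ... | no ¬r rewrite 𝟙-no (P? a) (¬r ∘ P⇒R) | 𝟙-no (Q? a) (¬r ∘ Q⇒R) = refl
  ... | yes r with split a a<n r
  ...   | inj₁ p rewrite 𝟙-yes (P? a) p | 𝟙-no (Q? a) (disjoint p) = refl
  ...   | inj₂ q rewrite 𝟙-no (P? a) (λ p → disjoint p q) | 𝟙-yes (Q? a) q = refl

-- Double counting of the incidences  P a ∧ σ a ≡ b.
count-bijection : ∀ {P Q : ℕ → Set} {n k} (P? : Decidable P) (Q? : Decidable Q) (σ : ℕ → ℕ) →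
  (∀ a → a < n → P a → σ a < k × Q (σ a)) →
  (∀ a a′ → a < n → a′ < n → P a → P a′ → σ a ≡ σ a′ → a ≡ a′) →
  (∀ b → b < k → Q b → ∃[ a ] a < n × P a × σ a ≡ b) →
  count n P? ≡ count k Q?
count-bijection {P} {Q} {n} {k} P? Q? σ maps injective surjective = begin
  sumBelow n (𝟙 ∘ P?)                            ≡⟨ sumBelow-cong n (λ a a<n → sym (row a a<n)) ⟩
  sumBelow n (λ a → sumBelow k (incidence a))    ≡⟨ sumBelow-swap n k incidence ⟩
  sumBelow k (λ b → sumBelow n (λ a → incidence a b)) ≡⟨ sumBelow-cong k column ⟩
  sumBelow k (𝟙 ∘ Q?)                            ∎
  where
  open ≡-Reasoning

  incidence : ℕ → ℕ → ℕ
  incidence a b = 𝟙 (P? a) * 𝟙 (σ a ≟ b)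

  row : ∀ a → a < n → sumBelow k (incidence a) ≡ 𝟙 (P? a)
  row a a<n with P? a
  ... | no _  = sumBelow-zero k (λ _ _ → refl)
  ... | yes p = sumBelow-single k (σ a) (proj₁ (maps a a<n p))
    (cong (λ i → i + 0) (𝟙-yes (σ a ≟ σ a) refl))
    (λ b _ b≢σa → cong (λ i → i + 0) (𝟙-no (σ a ≟ b) (b≢σa ∘ sym)))

  column : ∀ b → b < k → sumBelow n (λ a → incidence a b) ≡ 𝟙 (Q? b)
  column b b<k with Q? b
  ... | no ¬q = sumBelow-zero n off
    where
    off : ∀ a → a < n → incidence a b ≡ 0
    off a a<n with P? a
    ... | no _  = refl
    ... | yes p = cong (λ i → i + 0) (𝟙-no (σ a ≟ b) λ σa≡b →
      ¬q (subst Q σa≡b (proj₂ (maps a a<n p))))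
  ... | yes q with surjective b b<k q
  ...   | a₀ , a₀<n , pa₀ , σa₀≡b = sumBelow-single n a₀ a₀<n
    (cong₂ _*_ (𝟙-yes (P? a₀) pa₀) (𝟙-yes (σ a₀ ≟ b) σa₀≡b)) off
    where
    off : ∀ a → a < n → a ≢ a₀ → incidence a b ≡ 0
    off a a<n a≢a₀ with P? a
    ... | no _  = refl
    ... | yes p = cong (λ i → i + 0) (𝟙-no (σ a ≟ b) λ σa≡b →
      a≢a₀ (injective a a₀ a<n a₀<n p pa₀ (trans σa≡b (sym σa₀≡b))))

<∧∣⇒≡0 : ∀ {x d} → x < d → d ∣ x → x ≡ 0
<∧∣⇒≡0 {zero}  _   _   = refl
<∧∣⇒≡0 {suc x} x<d d∣x = contradiction d∣x (>⇒∤ x<d)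

0<∧<⇒∤ : ∀ {x d} → 0 < x → x < d → ¬ d ∣ x
0<∧<⇒∤ 0<x x<d d∣x = <⇒≢ 0<x (sym (<∧∣⇒≡0 x<d d∣x))

∣+m-+n∣≡n∸m : ∀ {m n} → m ≤ n → ∣ + m ℤ.- + n ∣ ≡ n ∸ m
∣+m-+n∣≡n∸m {m} {n} m≤n = trans (cong ∣_∣ (ℤ.[+m]-[+n]≡m⊖n m n)) (ℤ.∣⊖∣-≤ m≤n)

∣+m-+n∣≡m∸n : ∀ {m n} → n ≤ m → ∣ + m ℤ.- + n ∣ ≡ m ∸ n
∣+m-+n∣≡m∸n {m} {n} n≤m = trans (ℤ.∣i-j∣≡∣j-i∣ (+ m) (+ n)) (∣+m-+n∣≡n∸m n≤m)

∣-1-+n∣≡1+n : ∀ n → ∣ -[1+ 0 ] ℤ.- + n ∣ ≡ suc n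
∣-1-+n∣≡1+n zero    = refl
∣-1-+n∣≡1+n (suc n) = refl

module _ (d : ℕ) .{{_ : NonZero d}} where

  %-cong-+ : ∀ {x x′ y y′} → x % d ≡ x′ % d → y % d ≡ y′ % d → (x + y) % d ≡ (x′ + y′) % d
  %-cong-+ {x} {x′} {y} {y′} ex ey = begin
    (x + y) % d               ≡⟨ %-distribˡ-+ x y d ⟩
    (x % d + y % d) % d       ≡⟨ cong₂ (λ u v → (u + v) % d) ex ey ⟩
    (x′ % d + y′ % d) % d     ≡⟨ %-distribˡ-+ x′ y′ d ⟨
    (x′ + y′) % d             ∎
    where open ≡-Reasoning

  %-cong-* : ∀ {x x′ y y′} → x % d ≡ x′ % d → y % d ≡ y′ % d → (x * y) % d ≡ (x′ * y′) % d
  %-cong-* {x} {x′} {y} {y′} ex ey = begin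
    (x * y) % d               ≡⟨ %-distribˡ-* x y d ⟩
    ((x % d) * (y % d)) % d   ≡⟨ cong₂ (λ u v → (u * v) % d) ex ey ⟩
    ((x′ % d) * (y′ % d)) % d ≡⟨ %-distribˡ-* x′ y′ d ⟨
    (x′ * y′) % d             ∎
    where open ≡-Reasoning

  %-congʳ-* : ∀ x {y y′} → y % d ≡ y′ % d → (x * y) % d ≡ (x * y′) % d
  %-congʳ-* x = %-cong-* {x} refl

  %-cong-^ : ∀ {x y} k → x % d ≡ y % d → (x ^ k) % d ≡ (y ^ k) % d
  %-cong-^ zero    e = refl
  %-cong-^ (suc k) e = %-cong-* e (%-cong-^ k e)

  ∣-resp-% : ∀ {a b} → a % d ≡ b % d → d ∣ a → d ∣ b
  ∣-resp-% {a} {b} a≡b d∣a = m%n≡0⇒n∣m b d (trans (sym a≡b) (n∣m⇒m%n≡0 a d d∣a))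

  %-cong-divisor : ∀ {e x y} .{{_ : NonZero e}} → e ∣ d → x % d ≡ y % d → x % e ≡ y % e
  %-cong-divisor {e} {x} {y} e∣d x≡y = begin
    x % e     ≡⟨ m∣n⇒o%n%m≡o%m e d x e∣d ⟨
    x % d % e ≡⟨ cong (_% e) x≡y ⟩
    y % d % e ≡⟨ m∣n⇒o%n%m≡o%m e d y e∣d ⟩
    y % e     ∎
    where open ≡-Reasoning

module _ {d : ℕ} .{{_ : NonZero d}} where

  %≡⇒∣∸ : ∀ {x y} → x ≤ y → x % d ≡ y % d → d ∣ y ∸ x
  %≡⇒∣∸ {x} {y} x≤y e = divides (y / d ∸ x / d) (begin
    y ∸ x                                       ≡⟨ cong₂ _∸_ (m≡m%n+[m/n]*n y d) (m≡m%n+[m/n]*n x d) ⟩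
    (y % d + y / d * d) ∸ (x % d + x / d * d)   ≡⟨ cong (λ r → (y % d + y / d * d) ∸ (r + x / d * d)) e ⟩
    (y % d + y / d * d) ∸ (y % d + x / d * d)   ≡⟨ [m+n]∸[m+o]≡n∸o (y % d) _ _ ⟩
    y / d * d ∸ x / d * d                       ≡⟨ *-distribʳ-∸ d (y / d) (x / d) ⟨
    (y / d ∸ x / d) * d                         ∎)
    where open ≡-Reasoning

  ∣∸⇒%≡ : ∀ {x y} → x ≤ y → d ∣ y ∸ x → x % d ≡ y % d
  ∣∸⇒%≡ {x} {y} x≤y d∣y∸x = begin
    x % d             ≡⟨ %-remove-+ʳ x d∣y∸x ⟨
    (x + (y ∸ x)) % d ≡⟨ cong (_% d) (m+[n∸m]≡n x≤y) ⟩
    y % d             ∎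
    where open ≡-Reasoning

  ∤⇒0<% : ∀ {x} → ¬ d ∣ x → 0 < x % d
  ∤⇒0<% {x} d∤x = n≢0⇒n>0 (d∤x ∘ m%n≡0⇒n∣m x d)

  %-square-symmetric : ∀ {x y} → y + x ≡ d → (y * y) % d ≡ (x * x) % d
  %-square-symmetric {x} {y} y+x≡d = begin
    (y * y) % d               ≡⟨ %-remove-+ʳ (y * y) (n∣m*n x) ⟨
    (y * y + x * d) % d       ≡⟨ cong (λ z → (y * y + x * z) % d) (sym y+x≡d) ⟩
    (y * y + x * (y + x)) % d ≡⟨ cong (_% d) (swap-squares x y) ⟩
    (x * x + y * (y + x)) % d ≡⟨ cong (λ z → (x * x + y * z) % d) y+x≡d ⟩
    (x * x + y * d) % d       ≡⟨ %-remove-+ʳ (x * x) (n∣m*n y) ⟩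
    (x * x) % d               ∎
    where
    open ≡-Reasoning
    swap-squares : ∀ x y → y * y + x * (y + x) ≡ x * x + y * (y + x)
    swap-squares = solve-∀

  %≡⇒[mod] : ∀ {x y} → x % d ≡ y % d → (+ x) ≡ (+ y) [mod d ]
  %≡⇒[mod] {x} {y} e with ≤-total x y
  ... | inj₁ x≤y = subst (d ∣_) (sym (∣+m-+n∣≡n∸m x≤y)) (%≡⇒∣∸ x≤y e)
  ... | inj₂ y≤x = subst (d ∣_) (sym (∣+m-+n∣≡m∸n y≤x)) (%≡⇒∣∸ y≤x (sym e))

  [mod]⇒%≡ : ∀ {x y} → (+ x) ≡ (+ y) [mod d ] → x % d ≡ y % d
  [mod]⇒%≡ {x} {y} d∣ with ≤-total x y
  ... | inj₁ x≤y = ∣∸⇒%≡ x≤y (subst (d ∣_) (∣+m-+n∣≡n∸m x≤y) d∣)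
  ... | inj₂ y≤x = sym (∣∸⇒%≡ y≤x (subst (d ∣_) (∣+m-+n∣≡m∸n y≤x) d∣))

  coprime-resp-% : ∀ {a b} → a % d ≡ b % d → Coprime a d → Coprime b d
  coprime-resp-% {a} {b} e c (e∣b , e∣d) =
    c (∣n∣m%n⇒∣m e∣d (subst (_ ∣_) (sym e) (%-presˡ-∣ e∣b e∣d)) , e∣d)

  %-cancelˡ : ∀ u v a → (u * v) % d ≡ 1 % d → (u * ((v * a) % d)) % d ≡ a % d
  %-cancelˡ u v a uv≡1 = begin
    (u * ((v * a) % d)) % d ≡⟨ %-congʳ-* d u (m%n%n≡m%n (v * a) d) ⟩
    (u * (v * a)) % d       ≡⟨ cong (_% d) (*-assoc u v a) ⟨
    (u * v * a) % d         ≡⟨ %-cong-* d uv≡1 refl ⟩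
    (1 * a) % d             ≡⟨ cong (_% d) (*-identityˡ a) ⟩
    a % d                   ∎
    where open ≡-Reasoning

%-inverse : ∀ {d} .{{_ : NonZero d}} → 1 < d → ∀ {b} → Coprime b d → ∃[ b′ ] (b * b′) % d ≡ 1
%-inverse {suc k} 1<d {b} c with Coprimality.coprime-Bézout c
... | Bézout.+- x y 1+yd≡xb = x , (begin
  (b * x) % suc k       ≡⟨ cong (_% suc k) (trans (*-comm b x) (sym 1+yd≡xb)) ⟩
  (1 + y * suc k) % suc k ≡⟨ %-remove-+ʳ 1 (n∣m*n y) ⟩
  1 % suc k             ≡⟨ m<n⇒m%n≡m 1<d ⟩
  1                     ∎)
  where open ≡-Reasoning
-- Here x b ≡ −1 and k ≡ −1 (mod k + 1), so k x inverts b.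
... | Bézout.-+ x y 1+xb≡yd = k * x , (begin
  (b * (k * x)) % suc k                ≡⟨ %-remove-+ʳ (b * (k * x)) (n∣n {suc k}) ⟨
  (b * (k * x) + suc k) % suc k        ≡⟨ cong (_% suc k) (rearrange k b x) ⟩
  (1 + k * (1 + x * b)) % suc k        ≡⟨ cong (λ z → (1 + k * z) % suc k) 1+xb≡yd ⟩
  (1 + k * (y * suc k)) % suc k        ≡⟨ %-remove-+ʳ 1 (∣n⇒∣m*n k (n∣m*n y)) ⟩
  1 % suc k                            ≡⟨ m<n⇒m%n≡m 1<d ⟩
  1                                    ∎)
  where
  open ≡-Reasoning
  rearrange : ∀ k b x → b * (k * x) + suc k ≡ 1 + k * (1 + x * b)
  rearrange = solve-∀

coprime-*ʳ : ∀ {x y z} → Coprime x y → Coprime x z → Coprime x (y * z)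
coprime-*ʳ cxy cxz (e∣x , e∣yz) =
  cxz (e∣x , coprime-divisor (λ (f∣e , f∣y) → cxy (∣-trans f∣e e∣x , f∣y)) e∣yz)

coprime-*ˡ : ∀ {x y z} → Coprime x z → Coprime y z → Coprime (x * y) z
coprime-*ˡ cxz cyz = Coprimality.sym (coprime-*ʳ (Coprimality.sym cxz) (Coprimality.sym cyz))

coprime-∣ʳ : ∀ {a n e} → Coprime a n → e ∣ n → Coprime a e
coprime-∣ʳ c e∣n (f∣a , f∣e) = c (f∣a , ∣-trans f∣e e∣n)

coprime-*⇒coprimeʳ : ∀ {x y z} → Coprime (x * y) z → Coprime y z
coprime-*⇒coprimeʳ {x} c (e∣y , e∣z) = c (∣n⇒∣m*n x e∣y , e∣z)

coprime-*-% : ∀ {x y d} .{{_ : NonZero d}} → Coprime x d → Coprime y d → Coprime ((x * y) % d) d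
coprime-*-% {x} {y} {d} cx cy =
  coprime-resp-% {d} {x * y} {(x * y) % d} (sym (m%n%n≡m%n (x * y) d)) (coprime-*ˡ cx cy)

chineseRemainder : ∀ {q m} .{{_ : NonZero q}} .{{_ : NonZero m}} → 1 < q → 1 < m → Coprime q m →
  ∀ x y → ∃[ b ] b % q ≡ x % q × b % m ≡ y % m
chineseRemainder {q} {m} 1<q 1<m cqm x y
  with %-inverse 1<q (Coprimality.sym cqm) | %-inverse 1<m cqm
... | v , mv≡1 | u , qu≡1 = x * (m * v) + y * (q * u) , b%q , b%m
  where
  open ≡-Reasoning

  b%q : (x * (m * v) + y * (q * u)) % q ≡ x % q
  b%q = begin
    (x * (m * v) + y * (q * u)) % q ≡⟨ %-remove-+ʳ _ (∣n⇒∣m*n y (m∣m*n u)) ⟩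
    (x * (m * v)) % q               ≡⟨ %-congʳ-* q x (trans mv≡1 (sym (m<n⇒m%n≡m 1<q))) ⟩
    (x * 1) % q                     ≡⟨ cong (_% q) (*-identityʳ x) ⟩
    x % q                           ∎

  b%m : (x * (m * v) + y * (q * u)) % m ≡ y % m
  b%m = begin
    (x * (m * v) + y * (q * u)) % m ≡⟨ %-remove-+ˡ _ (∣n⇒∣m*n x (m∣m*n v)) ⟩
    (y * (q * u)) % m               ≡⟨ %-congʳ-* m y (trans qu≡1 (sym (m<n⇒m%n≡m 1<m))) ⟩
    (y * 1) % m                     ≡⟨ cong (_% m) (*-identityʳ y) ⟩
    y % m                           ∎

count-*-bijection : ∀ {P Q : ℕ → Set} {n} .{{_ : NonZero n}} (P? : Decidable P) (Q? : Decidable Q) u u′ →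
  (u * u′) % n ≡ 1 % n →
  (∀ a → a < n → P a → Q ((u * a) % n)) → (∀ b → b < n → Q b → P ((u′ * b) % n)) →
  count n P? ≡ count n Q?
count-*-bijection {P} {Q} {n} P? Q? u u′ uu′≡1 P⇒Q Q⇒P =
  count-bijection P? Q? (λ a → (u * a) % n) maps injective surjective
  where
  u′u≡1 : (u′ * u) % n ≡ 1 % n
  u′u≡1 = trans (cong (_% n) (*-comm u′ u)) uu′≡1

  maps : ∀ a → a < n → P a → (u * a) % n < n × Q ((u * a) % n)
  maps a a<n pa = m%n<n (u * a) n , P⇒Q a a<n pa

  injective : ∀ a a′ → a < n → a′ < n → P a → P a′ → (u * a) % n ≡ (u * a′) % n → a ≡ a′
  injective a a′ a<n a′<n _ _ ua≡ua′ = begin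
    a                         ≡⟨ m<n⇒m%n≡m a<n ⟨
    a % n                     ≡⟨ %-cancelˡ u′ u a u′u≡1 ⟨
    (u′ * ((u * a) % n)) % n  ≡⟨ cong (λ z → (u′ * z) % n) ua≡ua′ ⟩
    (u′ * ((u * a′) % n)) % n ≡⟨ %-cancelˡ u′ u a′ u′u≡1 ⟩
    a′ % n                    ≡⟨ m<n⇒m%n≡m a′<n ⟩
    a′                        ∎
    where open ≡-Reasoning

  surjective : ∀ b → b < n → Q b → ∃[ a ] a < n × P a × (u * a) % n ≡ b
  surjective b b<n qb = (u′ * b) % n , m%n<n (u′ * b) n , Q⇒P b b<n qb ,
    trans (%-cancelˡ u u′ b uu′≡1) (m<n⇒m%n≡m b<n)

module _ (p : ℕ) .{{_ : NonZero p}} where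

  IsQR : ℕ → Set
  IsQR a = ∃[ x ] x < p × (x * x) % p ≡ a % p

  private
    SquareRootBelow : ℕ → Set
    SquareRootBelow a = Any (λ x → (+ (x * x)) ≡ (+ a) [mod p ]) (upTo p)

    squareRootBelow⇒IsQR : ∀ {a} → SquareRootBelow a → IsQR a
    squareRootBelow⇒IsQR sr with Any.applyUpTo⁻ id sr
    ... | x , x<p , x²≡a = x , x<p , [mod]⇒%≡ x²≡a

    IsQR⇒squareRootBelow : ∀ {a} → IsQR a → SquareRootBelow a
    IsQR⇒squareRootBelow (x , x<p , x²≡a) = Any.applyUpTo⁺ id (%≡⇒[mod] x²≡a) x<p

  isQR? : Decidable IsQR
  isQR? a = map′ squareRootBelow⇒IsQR IsQR⇒squareRootBelow
    (any? (λ x → (+ (x * x)) ≡? (+ a) [mod p ]) (upTo p))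

  IsQR-resp-% : ∀ {a b} → a % p ≡ b % p → IsQR a → IsQR b
  IsQR-resp-% a≡b (x , x<p , x²≡a) = x , x<p , trans x²≡a a≡b

  legendre≡0 : ∀ {a} → p ∣ a → legendre a p ≡ + 0
  legendre≡0 {a} p∣a with p ∣? a
  ... | yes _  = refl
  ... | no p∤a = contradiction p∣a p∤a

  legendre≡1 : ∀ {a} → ¬ p ∣ a → IsQR a → legendre a p ≡ + 1
  legendre≡1 {a} p∤a qr with p ∣? a
  ... | yes p∣a = contradiction p∣a p∤a
  ... | no _ with any? (λ x → (+ (x * x)) ≡? (+ a) [mod p ]) (upTo p)
  ...   | yes _ = refl
  ...   | no ¬sr = contradiction (IsQR⇒squareRootBelow qr) ¬sr

  legendre≡-1 : ∀ {a} → ¬ p ∣ a → ¬ IsQR a → legendre a p ≡ -[1+ 0 ]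
  legendre≡-1 {a} p∤a ¬qr with p ∣? a
  ... | yes p∣a = contradiction p∣a p∤a
  ... | no _ with any? (λ x → (+ (x * x)) ≡? (+ a) [mod p ]) (upTo p)
  ...   | yes sr = contradiction (squareRootBelow⇒IsQR sr) ¬qr
  ...   | no _   = refl

  legendre-cong : ∀ {a b} → a % p ≡ b % p → legendre a p ≡ legendre b p
  legendre-cong {a} {b} a≡b = byCases (p ∣? a) (isQR? a)
    where
    p∤-resp : ¬ p ∣ a → ¬ p ∣ b
    p∤-resp p∤a = p∤a ∘ ∣-resp-% p (sym a≡b)

    byCases : Dec (p ∣ a) → Dec (IsQR a) → legendre a p ≡ legendre b p
    byCases (yes p∣a) _        = trans (legendre≡0 p∣a) (sym (legendre≡0 (∣-resp-% p a≡b p∣a)))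
    byCases (no p∤a)  (yes qr) =
      trans (legendre≡1 p∤a qr) (sym (legendre≡1 (p∤-resp p∤a) (IsQR-resp-% a≡b qr)))
    byCases (no p∤a)  (no ¬qr) =
      trans (legendre≡-1 p∤a ¬qr) (sym (legendre≡-1 (p∤-resp p∤a) (¬qr ∘ IsQR-resp-% (sym a≡b))))

module _ {p : ℕ} (prime : Prime p) where

  private instance
    p≢0 : NonZero p
    p≢0 = prime⇒nonZero prime

  1<p : 1 < p
  1<p = nonTrivial⇒n>1 p {{prime⇒nonTrivial prime}}

  ∤-* : ∀ {x y} → ¬ p ∣ x → ¬ p ∣ y → ¬ p ∣ x * y
  ∤-* {x} {y} p∤x p∤y p∣xy = [ p∤x , p∤y ]′ (euclidsLemma x y prime p∣xy)

  ∤⇒coprime : ∀ {x} → ¬ p ∣ x → Coprime x p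
  ∤⇒coprime p∤x (e∣x , e∣p) with prime⇒irreducible prime e∣p
  ... | inj₁ e≡1 = e≡1
  ... | inj₂ refl = contradiction e∣x p∤x

  -- If  x² ≡ a  and  y² ≡ c a  then  c ≡ (y x⁻¹)².
  IsQR-cancelʳ : ∀ {a c} → ¬ p ∣ a → IsQR p a → IsQR p (c * a) → IsQR p c
  IsQR-cancelʳ {a} {c} p∤a (x , _ , x²≡a) (y , _ , y²≡ca) with %-inverse 1<p (∤⇒coprime p∤x)
    where
    p∤x : ¬ p ∣ x
    p∤x p∣x = p∤a (∣-resp-% p x²≡a (∣n⇒∣m*n x p∣x))
  ... | v , xv≡1 = (y * v) % p , m%n<n (y * v) p , (begin
    ((y * v) % p * ((y * v) % p)) % p ≡⟨ %-cong-* p (m%n%n≡m%n (y * v) p) (m%n%n≡m%n (y * v) p) ⟩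
    (y * v * (y * v)) % p             ≡⟨ cong (_% p) (regroup₁ y v) ⟩
    (y * y * (v * v)) % p             ≡⟨ %-cong-* p y²≡ca refl ⟩
    (c * a * (v * v)) % p             ≡⟨ cong (_% p) (*-assoc c a (v * v)) ⟩
    (c * (a * (v * v))) % p           ≡⟨ %-congʳ-* p c (%-cong-* p (sym x²≡a) refl) ⟩
    (c * (x * x * (v * v))) % p       ≡⟨ cong (λ z → (c * z) % p) (regroup₂ x v) ⟩
    (c * (x * v * (x * v))) % p       ≡⟨ %-congʳ-* p c (%-cong-* p xv≡1′ xv≡1′) ⟩
    (c * 1) % p                       ≡⟨ cong (_% p) (*-identityʳ c) ⟩
    c % p                             ∎)
    where
    open ≡-Reasoning
    xv≡1′ : (x * v) % p ≡ 1 % p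
    xv≡1′ = trans xv≡1 (sym (m<n⇒m%n≡m 1<p))
    regroup₁ : ∀ y v → y * v * (y * v) ≡ y * y * (v * v)
    regroup₁ = solve-∀
    regroup₂ : ∀ x v → x * x * (v * v) ≡ x * v * (x * v)
    regroup₂ = solve-∀

  %-square-injective : ∀ {a a′} → a ≤ a′ → a′ + a < p →
    (a * a) % p ≡ (a′ * a′) % p → a ≡ a′
  %-square-injective {a} a≤a′ a′+a<p a²≡a′² with m≤n⇒∃[o]m+o≡n a≤a′
  ... | d , refl with euclidsLemma d (a + d + a) prime p∣d[a′+a]
    where
    difference-of-squares : ∀ a d → (a + d) * (a + d) ≡ a * a + d * (a + d + a)
    difference-of-squares = solve-∀
    p∣d[a′+a] : p ∣ d * (a + d + a)
    p∣d[a′+a] = subst (p ∣_)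
      (trans (cong (_∸ a * a) (difference-of-squares a d)) (m+n∸m≡n (a * a) _))
      (%≡⇒∣∸ (*-mono-≤ a≤a′ a≤a′) a²≡a′²)
  ... | inj₁ p∣d = sym (trans (cong (λ z → a + z) (<∧∣⇒≡0 d<p p∣d)) (+-identityʳ a))
    where
    d<p : d < p
    d<p = ≤-<-trans (m≤n+m d a) (≤-<-trans (m≤m+n (a + d) a) a′+a<p)
  ... | inj₂ p∣a′+a = trans (m+n≡0⇒m≡0 a a+d≡0) (sym a+d≡0)
    where
    a+d≡0 : a + d ≡ 0
    a+d≡0 = m+n≡0⇒m≡0 (a + d) (<∧∣⇒≡0 a′+a<p p∣a′+a)

odd⇒≡1+[n/2+n/2] : ∀ {n} → ¬ 2 ∣ n → suc (n / 2 + n / 2) ≡ n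
odd⇒≡1+[n/2+n/2] {n} 2∤n = sym (begin
  n                   ≡⟨ m≡m%n+[m/n]*n n 2 ⟩
  n % 2 + n / 2 * 2   ≡⟨ cong₂ _+_ n%2≡1 (*-comm (n / 2) 2) ⟩
  1 + 2 * (n / 2)     ≡⟨ cong (λ z → suc (n / 2 + z)) (+-identityʳ (n / 2)) ⟩
  suc (n / 2 + n / 2) ∎)
  where
  open ≡-Reasoning
  n%2≡1 : n % 2 ≡ 1
  n%2≡1 with n % 2 in eq | m%n<n n 2
  ... | 0 | _ = contradiction (m%n≡0⇒n∣m n 2 eq) 2∤n
  ... | 1 | _ = refl
  ... | suc (suc _) | s≤s (s≤s ())

module _ {p : ℕ} (prime : Prime p) (p-odd : ¬ 2 ∣ p) where

  private instance
    p≢0 : NonZero p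
    p≢0 = prime⇒nonZero prime

  private
    h : ℕ
    h = p / 2

    1+[h+h]≡p : suc (h + h) ≡ p
    1+[h+h]≡p = odd⇒≡1+[n/2+n/2] p-odd

  IsNonzeroQR : ℕ → Set
  IsNonzeroQR a = 0 < a × IsQR p a

  isNonzeroQR? : Decidable IsNonzeroQR
  isNonzeroQR? a = (0 <? a) ×-dec isQR? p a

  IsNonresidue : ℕ → Set
  IsNonresidue a = 0 < a × ¬ IsQR p a

  isNonresidue? : Decidable IsNonresidue
  isNonresidue? a = (0 <? a) ×-dec ¬? (isQR? p a)

  -- a ↦ a² is a bijection from 1, …, h onto the nonzero squares, since (p − x)² ≡ x².
  count-nonzeroQR : count p isNonzeroQR? ≡ h
  count-nonzeroQR = begin
    count p isNonzeroQR?
      ≡⟨ count-bijection (0 <?_) isNonzeroQR? (λ a → (a * a) % p) maps injective surjective ⟨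
    count (suc h) (0 <?_)
      ≡⟨ count-positive h ⟩
    h ∎
    where
    open ≡-Reasoning
    ≤h⇒<p : ∀ {a} → a ≤ h → a < p
    ≤h⇒<p a≤h = subst (_ <_) 1+[h+h]≡p (s≤s (≤-trans a≤h (m≤m+n h h)))

    sum<p : ∀ {x y} → x ≤ h → y ≤ h → x + y < p
    sum<p x≤h y≤h = subst (_ <_) 1+[h+h]≡p (s≤s (+-mono-≤ x≤h y≤h))

    maps : ∀ a → a < suc h → 0 < a → (a * a) % p < p × IsNonzeroQR ((a * a) % p)
    maps a (s≤s a≤h) 0<a = m%n<n (a * a) p ,
      ∤⇒0<% (∤-* prime p∤a p∤a) , a , ≤h⇒<p a≤h , sym (m%n%n≡m%n (a * a) p)
      where
      p∤a : ¬ p ∣ a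
      p∤a = 0<∧<⇒∤ 0<a (≤h⇒<p a≤h)

    injective : ∀ a a′ → a < suc h → a′ < suc h → 0 < a → 0 < a′ →
      (a * a) % p ≡ (a′ * a′) % p → a ≡ a′
    injective a a′ (s≤s a≤h) (s≤s a′≤h) _ _ a²≡a′² with ≤-total a a′
    ... | inj₁ a≤a′ = %-square-injective prime a≤a′ (sum<p a′≤h a≤h) a²≡a′²
    ... | inj₂ a′≤a = sym (%-square-injective prime a′≤a (sum<p a≤h a′≤h) (sym a²≡a′²))

    surjective : ∀ b → b < p → IsNonzeroQR b → ∃[ a ] a < suc h × 0 < a × (a * a) % p ≡ b
    surjective b b<p (0<b , x , x<p , x²≡b) with x ≤? h
    ... | yes x≤h = x , s≤s x≤h , n≢0⇒n>0 x≢0 , x²≡b′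
      where
      x²≡b′ : (x * x) % p ≡ b
      x²≡b′ = trans x²≡b (m<n⇒m%n≡m b<p)
      x≢0 : x ≢ 0
      x≢0 refl = <⇒≢ 0<b (sym (trans (sym x²≡b′) (n∣m⇒m%n≡0 0 p (p ∣0))))
    ... | no x≰h = p ∸ x , s≤s p∸x≤h , m<n⇒0<n∸m x<p ,
      trans (%-square-symmetric {x = x} (m∸n+n≡m (<⇒≤ x<p))) (trans x²≡b (m<n⇒m%n≡m b<p))
      where
      p∸x≤h : p ∸ x ≤ h
      p∸x≤h = ≤-trans (∸-monoʳ-≤ p (≰⇒> x≰h))
        (≤-reflexive (trans (cong (_∸ suc h) (sym 1+[h+h]≡p)) (m+n∸m≡n (suc h) h)))

  count-nonresidue : count p isNonresidue? ≡ h
  count-nonresidue = +-cancelˡ-≡ h _ _ (begin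
    h + count p isNonresidue?                    ≡⟨ cong (λ z → z + count p isNonresidue?) count-nonzeroQR ⟨
    count p isNonzeroQR? + count p isNonresidue? ≡⟨ count-partition (0 <?_) isNonzeroQR? isNonresidue?
                                                      split proj₁ proj₁ (λ (_ , qr) (_ , ¬qr) → ¬qr qr) ⟨
    count p (0 <?_)                              ≡⟨ cong (λ q → count q (0 <?_)) 1+[h+h]≡p ⟨
    count (suc (h + h)) (0 <?_)                  ≡⟨ count-positive (h + h) ⟩
    h + h                                        ∎)
    where
    open ≡-Reasoning
    split : ∀ a → a < p → 0 < a → IsNonzeroQR a ⊎ IsNonresidue a
    split a _ 0<a with isQR? p a
    ... | yes qr = inj₁ (0<a , qr)
    ... | no ¬qr = inj₂ (0<a , ¬qr)

  ∃nonresidue : ∃[ c ] c < p × IsNonresidue c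
  ∃nonresidue with count-<⇒∃ isNonzeroQR? (0 <?_) h<h+h
    where
    h<h+h : count p isNonzeroQR? < count p (0 <?_)
    h<h+h = subst₂ _<_ (sym count-nonzeroQR)
      (trans (sym (count-positive (h + h))) (cong (λ q → count q (0 <?_)) 1+[h+h]≡p))
      (m<m+n h (m≥n⇒m/n>0 {p} {2} (1<p prime)))
  ... | c , c<p , 0<c , ¬nonzeroQR = c , c<p , 0<c , λ qr → ¬nonzeroQR (0<c , qr)

  module _ {c : ℕ} (c<p : c < p) (c-nonresidue : IsNonresidue c) where

    private
      p∤c : ¬ p ∣ c
      p∤c = 0<∧<⇒∤ (proj₁ c-nonresidue) c<p

      IsNonzeroQR[c*_] : ℕ → Set
      IsNonzeroQR[c* a ] = 0 < a × IsQR p (c * a)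

      isNonzeroQR[c*_]? : Decidable IsNonzeroQR[c*_]
      isNonzeroQR[c* a ]? = (0 <? a) ×-dec isQR? p (c * a)

      -- a ↦ c⁻¹ a maps the nonzero squares bijectively onto IsNonzeroQR[c*_].
      count-nonzeroQR[c*] : count p isNonzeroQR? ≡ count p isNonzeroQR[c*_]?
      count-nonzeroQR[c*] with %-inverse (1<p prime) (∤⇒coprime prime p∤c)
      ... | w , cw≡1 = count-*-bijection isNonzeroQR? isNonzeroQR[c*_]? w c wc≡1 toM fromM
        where
        cw≡1′ : (c * w) % p ≡ 1 % p
        cw≡1′ = trans cw≡1 (sym (m<n⇒m%n≡m (1<p prime)))
        wc≡1 : (w * c) % p ≡ 1 % p
        wc≡1 = trans (cong (_% p) (*-comm w c)) cw≡1′
        p∤w : ¬ p ∣ w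
        p∤w p∣w = 0≢1+n (trans (sym (n∣m⇒m%n≡0 _ p (∣n⇒∣m*n c p∣w))) cw≡1)

        toM : ∀ a → a < p → IsNonzeroQR a → IsNonzeroQR[c* (w * a) % p ]
        toM a a<p (0<a , qr) = ∤⇒0<% (∤-* prime p∤w (0<∧<⇒∤ 0<a a<p)) ,
          IsQR-resp-% p (sym (%-cancelˡ c w a cw≡1′)) qr

        fromM : ∀ b → b < p → IsNonzeroQR[c* b ] → IsNonzeroQR ((c * b) % p)
        fromM b b<p (0<b , qr) = ∤⇒0<% (∤-* prime p∤c (0<∧<⇒∤ 0<b b<p)) ,
          IsQR-resp-% p (sym (m%n%n≡m%n (c * b) p)) qr

      nonzeroQR[c*]⊆nonresidue : IsNonzeroQR[c*_] ⊆ IsNonresidue below p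
      nonzeroQR[c*]⊆nonresidue a a<p (0<a , qr-ca) = 0<a , λ qr-a →
        proj₂ c-nonresidue (IsQR-cancelʳ prime (0<∧<⇒∤ 0<a a<p) qr-a qr-ca)

      nonresidue⊆nonzeroQR[c*] : IsNonresidue ⊆ IsNonzeroQR[c*_] below p
      nonresidue⊆nonzeroQR[c*] = count-≡⇒⊇ isNonzeroQR[c*_]? isNonresidue? nonzeroQR[c*]⊆nonresidue
        (trans (sym count-nonzeroQR[c*]) (trans count-nonzeroQR (sym count-nonresidue)))

    IsQR-*-nonresidue : ∀ {a} → ¬ p ∣ a → ¬ IsQR p a → IsQR p (c * a)
    IsQR-*-nonresidue {a} p∤a ¬qr = IsQR-resp-% p (%-congʳ-* p c (m%n%n≡m%n a p))
      (proj₂ (nonresidue⊆nonzeroQR[c*] (a % p) (m%n<n a p)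
        (∤⇒0<% p∤a , ¬qr ∘ IsQR-resp-% p (m%n%n≡m%n a p))))

    legendre-*-nonresidue : ∀ {a} → ¬ p ∣ a → legendre (c * a) p ≡ ℤ.- legendre a p
    legendre-*-nonresidue {a} p∤a with isQR? p a
    ... | yes qr = trans
      (legendre≡-1 p (∤-* prime p∤c p∤a) (proj₂ c-nonresidue ∘ IsQR-cancelʳ prime p∤a qr))
      (cong ℤ.-_ (sym (legendre≡1 p p∤a qr)))
    ... | no ¬qr = trans
      (legendre≡1 p (∤-* prime p∤c p∤a) (IsQR-*-nonresidue p∤a ¬qr))
      (cong ℤ.-_ (sym (legendre≡-1 p p∤a ¬qr)))

  ∃-legendre-flip : ∃[ c ] ¬ p ∣ c × ∀ {a} → ¬ p ∣ a → legendre (c * a) p ≡ ℤ.- legendre a p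
  ∃-legendre-flip with ∃nonresidue
  ... | c , c<p , c-nonresidue =
    c , 0<∧<⇒∤ (proj₁ c-nonresidue) c<p , legendre-*-nonresidue c<p c-nonresidue

filter-applyUpTo-head : (P? : Decidable P) → ∀ f N {k ks} → filter P? (applyUpTo f N) ≡ k ∷ ks →
  ∃[ i ] f i ≡ k × P k × (∀ j → j < i → ¬ P (f j))
filter-applyUpTo-head P? f (suc N) eq with P? (f 0)
... | yes pf0 with refl ← eq = 0 , refl , pf0 , λ _ ()
... | no ¬pf0 with filter-applyUpTo-head P? (f ∘ suc) N eq
...   | i , fi≡k , pk , before = suc i , fi≡k , pk , λ where
  zero    _         → ¬pf0
  (suc j) (s≤s j<i) → before j j<i

leastDivisor : ℕ → ℕ
leastDivisor n = 2 + leastDivisorPred n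

private
  leastDivisorPred-spec : ∀ {n} → 2 ≤ n →
    leastDivisor n ∣ n × (∀ j → j < leastDivisorPred n → ¬ (2 + j) ∣ n)
  leastDivisorPred-spec {n} 2≤n with filter (λ k → (2 + k) ∣? n) (upTo (n ∸ 1)) in eq
  ... | [] = contradiction (subst (λ ks → 0 < length ks) eq (filter-some _ n∸2-divides)) λ ()
    where
    n∸2-divides : Any (λ k → (2 + k) ∣ n) (upTo (n ∸ 1))
    n∸2-divides = Any.applyUpTo⁺ id (subst (_∣ n) (sym (m+[n∸m]≡n 2≤n)) ∣-refl)
      (∸-monoʳ-< {n} ≤-refl 2≤n)
  ... | k ∷ _ with filter-applyUpTo-head (λ k → (2 + k) ∣? n) id (n ∸ 1) eq
  ...   | _ , refl , k∣n , before = k∣n , before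

leastDivisor-∣ : ∀ {n} → 2 ≤ n → leastDivisor n ∣ n
leastDivisor-∣ 2≤n = proj₁ (leastDivisorPred-spec 2≤n)

leastDivisor-prime : ∀ {n} → 2 ≤ n → Prime (leastDivisor n)
leastDivisor-prime {n} 2≤n = rough∧∣⇒prime rough (leastDivisor-∣ 2≤n)
  where
  rough : leastDivisor n Rough n
  rough (hasNonTrivialDivisor {suc (suc j)} (s≤s (s≤s j<)) d∣n) =
    proj₂ (leastDivisorPred-spec 2≤n) j j< d∣n

m/leastDivisor[m]≢0 : ∀ {m} → 2 ≤ m → NonZero (m / leastDivisor m)
m/leastDivisor[m]≢0 2≤m =
  >-nonZero (m≥n⇒m/n>0 (∣⇒≤ {{>-nonZero (<-trans z<s 2≤m)}} (leastDivisor-∣ 2≤m)))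

coprime⇒leastDivisor∤ : ∀ {a n} → 2 ≤ n → Coprime a n → ¬ leastDivisor n ∣ a
coprime⇒leastDivisor∤ 2≤n coprime q∣a = contradiction (coprime (q∣a , leastDivisor-∣ 2≤n)) λ ()

±1 : ℤ → Set
±1 z = z ≡ + 1 ⊎ z ≡ -[1+ 0 ]

±1-* : ∀ {x y} → ±1 x → ±1 y → ±1 (x ℤ.* y)
±1-* (inj₁ refl) (inj₁ refl) = inj₁ refl
±1-* (inj₁ refl) (inj₂ refl) = inj₂ refl
±1-* (inj₂ refl) (inj₁ refl) = inj₂ refl
±1-* (inj₂ refl) (inj₂ refl) = inj₁ refl

legendre-±1 : ∀ {p a} .{{_ : NonZero p}} → ¬ p ∣ a → ±1 (legendre a p)
legendre-±1 {p} {a} p∤a with isQR? p a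
... | yes qr = inj₁ (legendre≡1 p p∤a qr)
... | no ¬qr = inj₂ (legendre≡-1 p p∤a ¬qr)

jacobiFuel-suc : ∀ {m} f a → 2 ≤ m →
  jacobiFuel (suc f) a m ≡ legendre a (leastDivisor m) ℤ.* jacobiFuel f a (m / leastDivisor m)
jacobiFuel-suc {m} f a 2≤m with m ≤? 1
... | yes m≤1 = contradiction m≤1 (<⇒≱ 2≤m)
... | no _    = refl

jacobi-unfold : ∀ {n} a → 2 ≤ n →
  jacobi a n ≡ legendre a (leastDivisor n) ℤ.* jacobiFuel (n ∸ 1) a (n / leastDivisor n)
jacobi-unfold {suc n} a = jacobiFuel-suc n a

jacobiFuel-cong : ∀ f {a b m} .{{_ : NonZero m}} → a % m ≡ b % m → jacobiFuel f a m ≡ jacobiFuel f b m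
jacobiFuel-cong zero    _ = refl
jacobiFuel-cong (suc f) {a} {b} {m} a≡b with m ≤? 1
... | yes _   = refl
... | no m≰1 = cong₂ ℤ._*_
    (legendre-cong (leastDivisor m) {a} {b} (%-cong-divisor m (leastDivisor-∣ 2≤m) a≡b))
    (jacobiFuel-cong f {a} {b} {m / leastDivisor m} (%-cong-divisor m (m/n∣m (leastDivisor-∣ 2≤m)) a≡b))
  where
  2≤m : 2 ≤ m
  2≤m = ≰⇒> m≰1
  instance
    m/leastDivisor≢0 : NonZero (m / leastDivisor m)
    m/leastDivisor≢0 = m/leastDivisor[m]≢0 2≤m

jacobiFuel-±1 : ∀ f {a m} → Coprime a m → ±1 (jacobiFuel f a m)
jacobiFuel-±1 zero    _ = inj₁ refl
jacobiFuel-±1 (suc f) {a} {m} coprime with m ≤? 1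
... | yes _   = inj₁ refl
... | no m≰1 = ±1-* (legendre-±1 (coprime⇒leastDivisor∤ 2≤m coprime))
    (jacobiFuel-±1 f (coprime-∣ʳ coprime (m/n∣m (leastDivisor-∣ 2≤m))))
  where
  2≤m : 2 ≤ m
  2≤m = ≰⇒> m≰1

module _ {n : ℕ} (2≤n : 2 ≤ n) where

  private
    q n/q : ℕ
    q   = leastDivisor n
    n/q = n / q

    instance
      n≢0 : NonZero n
      n≢0 = >-nonZero (<-trans z<s 2≤n)
      n/q≢0 : NonZero n/q
      n/q≢0 = m/leastDivisor[m]≢0 2≤n

  jacobi-*-flip : ∀ {b c} → (∀ {a} → ¬ q ∣ a → legendre (c * a) q ≡ ℤ.- legendre a q) →
    b % q ≡ c % q → b % n/q ≡ 1 % n/q →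
    ∀ {a} → Coprime a n → jacobi ((b * a) % n) n ≡ ℤ.- jacobi a n
  jacobi-*-flip {b} {c} legendre-flip b≡c b≡1 {a} coprime[a] = begin
    jacobi ((b * a) % n) n
      ≡⟨ jacobi-unfold ((b * a) % n) 2≤n ⟩
    legendre ((b * a) % n) q ℤ.* jacobiFuel (n ∸ 1) ((b * a) % n) n/q
      ≡⟨ cong₂ ℤ._*_ (legendre-cong q {(b * a) % n} {c * a} ≡c*a[mod-q])
                     (jacobiFuel-cong (n ∸ 1) {(b * a) % n} {a} {n/q} ≡a[mod-n/q]) ⟩
    legendre (c * a) q ℤ.* jacobiFuel (n ∸ 1) a n/q
      ≡⟨ cong (ℤ._* jacobiFuel (n ∸ 1) a n/q) (legendre-flip (coprime⇒leastDivisor∤ 2≤n coprime[a])) ⟩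
    ℤ.- legendre a q ℤ.* jacobiFuel (n ∸ 1) a n/q
      ≡⟨ ℤ.neg-distribˡ-* (legendre a q) _ ⟨
    ℤ.- (legendre a q ℤ.* jacobiFuel (n ∸ 1) a n/q)
      ≡⟨ cong ℤ.-_ (jacobi-unfold a 2≤n) ⟨
    ℤ.- jacobi a n ∎
    where
    open ≡-Reasoning
    reduce : ∀ {e} .{{_ : NonZero e}} → e ∣ n → ((b * a) % n) % e ≡ (b * a) % e
    reduce e∣n = %-cong-divisor n e∣n (m%n%n≡m%n (b * a) n)
    ≡c*a[mod-q] : ((b * a) % n) % q ≡ (c * a) % q
    ≡c*a[mod-q] = trans (reduce (leastDivisor-∣ 2≤n)) (%-cong-* q {b} {c} {a} b≡c refl)
    ≡a[mod-n/q] : ((b * a) % n) % n/q ≡ a % n/q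
    ≡a[mod-n/q] = trans (reduce (m/n∣m (leastDivisor-∣ 2≤n)))
      (trans (%-cong-* n/q {b} {1} {a} b≡1 refl) (cong (_% n/q) (*-identityˡ a)))

module _ (n : ℕ) where

  IsJacobiPlus : ℕ → Set
  IsJacobiPlus a = Coprime a n × jacobi a n ≡ + 1

  isJacobiPlus? : Decidable IsJacobiPlus
  isJacobiPlus? a = coprime? a n ×-dec (jacobi a n ℤ.≟ + 1)

  IsJacobiMinus : ℕ → Set
  IsJacobiMinus a = Coprime a n × jacobi a n ≡ -[1+ 0 ]

  isJacobiMinus? : Decidable IsJacobiMinus
  isJacobiMinus? a = coprime? a n ×-dec (jacobi a n ℤ.≟ -[1+ 0 ])

  φ≡count-jacobiPlus+count-jacobiMinus : φ n ≡ count n isJacobiPlus? + count n isJacobiMinus?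
  φ≡count-jacobiPlus+count-jacobiMinus = trans (length-filter-upTo (λ a → coprime? a n) n)
    (count-partition (λ a → coprime? a n) isJacobiPlus? isJacobiMinus? split proj₁ proj₁
      (λ (_ , plus) (_ , minus) → +1≢-1 (trans (sym plus) minus)))
    where
    +1≢-1 : + 1 ≢ -[1+ 0 ]
    +1≢-1 ()
    split : ∀ a → a < n → Coprime a n → IsJacobiPlus a ⊎ IsJacobiMinus a
    split a _ coprime[a] with jacobiFuel-±1 n coprime[a]
    ... | inj₁ plus  = inj₁ (coprime[a] , plus)
    ... | inj₂ minus = inj₂ (coprime[a] , minus)

module _ {n : ℕ} .{{_ : NonZero n}} where

  count-jacobiMinus≡count-jacobiPlus : 1 < n → ∀ {b} → Coprime b n →
    (∀ {a} → Coprime a n → jacobi ((b * a) % n) n ≡ ℤ.- jacobi a n) →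
    count n (isJacobiMinus? n) ≡ count n (isJacobiPlus? n)
  count-jacobiMinus≡count-jacobiPlus 1<n {b} coprime[b] flip =
    let b′ , bb′≡1 = %-inverse 1<n coprime[b]
    in count-*-flip (trans bb′≡1 (sym (m<n⇒m%n≡m 1<n)))
    where
    count-*-flip : ∀ {b′} → (b * b′) % n ≡ 1 % n → count n (isJacobiMinus? n) ≡ count n (isJacobiPlus? n)
    count-*-flip {b′} bb′≡1 =
      count-*-bijection (isJacobiMinus? n) (isJacobiPlus? n) b b′ bb′≡1 toPlus toMinus
      where
      coprime[b′] : Coprime b′ n
      coprime[b′] = coprime-*⇒coprimeʳ {b} (coprime-resp-% (sym bb′≡1) (1-coprimeTo n))

      toPlus : ∀ a → a < n → IsJacobiMinus n a → IsJacobiPlus n ((b * a) % n)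
      toPlus a _ (coprime[a] , minus) =
        coprime-*-% coprime[b] coprime[a] , trans (flip coprime[a]) (cong ℤ.-_ minus)

      toMinus : ∀ a → a < n → IsJacobiPlus n a → IsJacobiMinus n ((b′ * a) % n)
      toMinus a _ (coprime[a] , plus) = coprime[b′a] , (begin
        jacobi ((b′ * a) % n) n                 ≡⟨ ℤ.neg-involutive _ ⟨
        ℤ.- (ℤ.- jacobi ((b′ * a) % n) n)       ≡⟨ cong ℤ.-_ (flip coprime[b′a]) ⟨
        ℤ.- jacobi ((b * ((b′ * a) % n)) % n) n ≡⟨ cong ℤ.-_ (jacobiFuel-cong n b[b′a]≡a) ⟩
        ℤ.- jacobi a n                          ≡⟨ cong ℤ.-_ plus ⟩
        -[1+ 0 ]                                ∎)
        where
        open ≡-Reasoning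
        coprime[b′a] : Coprime ((b′ * a) % n) n
        coprime[b′a] = coprime-*-% coprime[b′] coprime[a]
        b[b′a]≡a : ((b * ((b′ * a) % n)) % n) % n ≡ a % n
        b[b′a]≡a = trans (m%n%n≡m%n _ n) (%-cancelˡ b b′ a bb′≡1)

leastSatisfying : ∀ {P : ℕ → Set} → Decidable P → ∀ {N} → P N →
  ∃[ m ] P m × (∀ k → k < m → ¬ P k)
leastSatisfying {P} P? {N} = <-rec Goal step N
  where
  Goal : ℕ → Set
  Goal N = P N → ∃[ m ] P m × (∀ k → k < m → ¬ P k)

  step : ∀ N → (∀ {k} → k < N → Goal k) → Goal N
  step N below pN with anyUpTo? P? N
  ... | yes (k , k<N , pk) = below k<N pk
  ... | no none            = N , pN , λ k k<N pk → none (k , k<N , pk)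

IsExponent : ℕ → ℕ → Set
IsExponent n m = ∀ a → Coprime a n → (+ (a ^ m)) ≡ (+ 1) [mod n ]

HasEvenIndex : ℕ → Set
HasEvenIndex n = ∀ ℓ i → IsCarmichaelLambda n ℓ → i * ℓ ≡ n ∸ 1 → 2 ∣ i

module _ {n : ℕ} .{{_ : NonZero n}} where

  IsExponent⇒^% : ∀ m {a} → IsExponent n m → Coprime a n → (a ^ m) % n ≡ 1 % n
  IsExponent⇒^% m {a} exp coprime = [mod]⇒%≡ (exp a coprime)

  ^%⇒IsExponent : ∀ m → (∀ {a} → Coprime a n → (a ^ m) % n ≡ 1 % n) → IsExponent n m
  ^%⇒IsExponent m pow a coprime = %≡⇒[mod] (pow coprime)

  IsExponent-*ʳ : ∀ ℓ k → IsExponent n ℓ → IsExponent n (ℓ * k)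
  IsExponent-*ʳ ℓ k exp = ^%⇒IsExponent (ℓ * k) λ {a} coprime → begin
    (a ^ (ℓ * k)) % n ≡⟨ cong (_% n) (^-*-assoc a ℓ k) ⟨
    ((a ^ ℓ) ^ k) % n ≡⟨ %-cong-^ n k (IsExponent⇒^% ℓ exp coprime) ⟩
    (1 ^ k) % n       ≡⟨ cong (_% n) (^-zeroˡ k) ⟩
    1 % n             ∎
    where open ≡-Reasoning

  IsExponent-+-cancelʳ : ∀ r k → IsExponent n (r + k) → IsExponent n k → IsExponent n r
  IsExponent-+-cancelʳ r k exp[r+k] exp[k] = ^%⇒IsExponent r λ {a} coprime → begin
    (a ^ r) % n           ≡⟨ cong (_% n) (*-identityʳ (a ^ r)) ⟨
    (a ^ r * 1) % n       ≡⟨ %-congʳ-* n (a ^ r) (IsExponent⇒^% k exp[k] coprime) ⟨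
    (a ^ r * a ^ k) % n   ≡⟨ cong (_% n) (^-distribˡ-+-* a r k) ⟨
    (a ^ (r + k)) % n     ≡⟨ IsExponent⇒^% (r + k) exp[r+k] coprime ⟩
    1 % n                 ∎
    where open ≡-Reasoning

  isExponent? : Decidable (IsExponent n)
  isExponent? m = map′ fromBelow toBelow (allUpTo? (λ a → coprime? a n →-dec ((a ^ m) % n ≟ 1 % n)) n)
    where
    Below : Set
    Below = ∀ {a} → a < n → Coprime a n → (a ^ m) % n ≡ 1 % n

    toBelow : IsExponent n m → Below
    toBelow exp _ = IsExponent⇒^% m exp

    fromBelow : Below → IsExponent n m
    fromBelow pow = ^%⇒IsExponent m λ {a} coprime → trans (%-cong-^ n m (sym (m%n%n≡m%n a n)))
      (pow (m%n<n a n) (coprime-resp-% (sym (m%n%n≡m%n a n)) coprime))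

  ∃carmichaelLambda : ∀ {m} → 0 < m → IsExponent n m → ∃[ ℓ ] IsCarmichaelLambda n ℓ
  ∃carmichaelLambda 0<m exp
    with leastSatisfying (λ m → (0 <? m) ×-dec isExponent? m) (0<m , exp)
  ... | ℓ , (0<ℓ , exp[ℓ]) , below = ℓ , 0<ℓ , exp[ℓ] ,
    λ m 0<m exp[m] → ≮⇒≥ (λ m<ℓ → below m m<ℓ (0<m , exp[m]))

  carmichaelLambda∣ : ∀ {ℓ m} → IsCarmichaelLambda n ℓ → IsExponent n m → ℓ ∣ m
  carmichaelLambda∣ {ℓ} {m} (0<ℓ , exp[ℓ] , least) exp[m] = m%n≡0⇒n∣m m ℓ r≡0
    where
    instance
      ℓ≢0 : NonZero ℓ
      ℓ≢0 = >-nonZero 0<ℓ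
    exp[r] : IsExponent n (m % ℓ)
    exp[r] = IsExponent-+-cancelʳ (m % ℓ) (m / ℓ * ℓ) (subst (IsExponent n) (m≡m%n+[m/n]*n m ℓ) exp[m])
      (subst (IsExponent n) (*-comm ℓ (m / ℓ)) (IsExponent-*ʳ ℓ (m / ℓ) exp[ℓ]))
    r≡0 : m % ℓ ≡ 0
    r≡0 with m % ℓ ≟ 0
    ... | yes r≡0 = r≡0
    ... | no r≢0  = contradiction (least (m % ℓ) (n≢0⇒n>0 r≢0) exp[r]) (<⇒≱ (m%n<n m ℓ))

n∸1+1≡n : ∀ {n} .{{_ : NonZero n}} → n ∸ 1 + 1 ≡ n
n∸1+1≡n {n} = m∸n+n≡m (>-nonZero⁻¹ n)

-- Korselt's argument: if n ∣ m² then 1 + m is a unit with (1 + m)^(n−1) ≡ 1 + (n − 1) m.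
IsExponent[n∸1]⇒squarefree : ∀ {n m} .{{_ : NonZero n}} → IsExponent n (n ∸ 1) → n ∣ m * m → n ∣ m
IsExponent[n∸1]⇒squarefree {n} {m} fermat n∣m² =
  ∣m+n∣m⇒∣n (subst (n ∣_) [n∸1]m+m≡nm (m∣m*n m)) n∣[n∸1]m
  where
  open ≡-Reasoning

  [n∸1]m+m≡nm : n * m ≡ (n ∸ 1) * m + m
  [n∸1]m+m≡nm = begin
    n * m               ≡⟨ cong (_* m) n∸1+1≡n ⟨
    (n ∸ 1 + 1) * m     ≡⟨ *-distribʳ-+ m (n ∸ 1) 1 ⟩
    (n ∸ 1) * m + 1 * m ≡⟨ cong (λ z → (n ∸ 1) * m + z) (*-identityˡ m) ⟩
    (n ∸ 1) * m + m     ∎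

  binomial : ∀ k → ((1 + m) ^ k) % n ≡ (1 + k * m) % n
  binomial zero    = refl
  binomial (suc k) = begin
    ((1 + m) * (1 + m) ^ k) % n       ≡⟨ %-congʳ-* n (1 + m) (binomial k) ⟩
    ((1 + m) * (1 + k * m)) % n       ≡⟨ cong (_% n) (expand m k) ⟩
    (1 + suc k * m + k * (m * m)) % n ≡⟨ %-remove-+ʳ (1 + suc k * m) (∣n⇒∣m*n k n∣m²) ⟩
    (1 + suc k * m) % n               ∎
    where
    expand : ∀ m k → (1 + m) * (1 + k * m) ≡ 1 + suc k * m + k * (m * m)
    expand = solve-∀

  ∣1+m∧∣m⇒∣1 : ∀ {e} → e ∣ 1 + m → e ∣ m → e ≡ 1
  ∣1+m∧∣m⇒∣1 {e} e∣1+m e∣m = ∣1⇒≡1 (∣m+n∣m⇒∣n (subst (e ∣_) (+-comm 1 m) e∣1+m) e∣m)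

  coprime[1+m] : Coprime (1 + m) n
  coprime[1+m] {e} (e∣1+m , e∣n) = ∣1+m∧∣m⇒∣1 e∣1+m e∣m
    where
    e∣m : e ∣ m
    e∣m = coprime-divisor (λ (f∣e , f∣m) → ∣1+m∧∣m⇒∣1 (∣-trans f∣e e∣1+m) f∣m)
      (∣-trans e∣n n∣m²)

  n∣[n∸1]m : n ∣ (n ∸ 1) * m
  n∣[n∸1]m = %≡⇒∣∸ (s≤s z≤n) (begin
    1 % n                   ≡⟨ IsExponent⇒^% (n ∸ 1) fermat coprime[1+m] ⟨
    ((1 + m) ^ (n ∸ 1)) % n ≡⟨ binomial (n ∸ 1) ⟩
    (1 + (n ∸ 1) * m) % n   ∎)

[n∸1]²≡1 : ∀ {n} .{{_ : NonZero n}} → ((n ∸ 1) * (n ∸ 1)) % n ≡ 1 % n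
[n∸1]²≡1 {n} = begin
  (x * x) % n           ≡⟨ %-remove-+ʳ (x * x) (∣-reflexive (sym n∸1+1≡n)) ⟨
  (x * x + (x + 1)) % n ≡⟨ cong (_% n) (rearrange x) ⟩
  (1 + x * (x + 1)) % n ≡⟨ %-remove-+ʳ 1 (∣n⇒∣m*n x (∣-reflexive (sym n∸1+1≡n))) ⟩
  1 % n                 ∎
  where
  open ≡-Reasoning
  x : ℕ
  x = n ∸ 1
  rearrange : ∀ x → x * x + (x + 1) ≡ 1 + x * (x + 1)
  rearrange = solve-∀

[n∸1]^[j*2]≡1 : ∀ {n} .{{_ : NonZero n}} j → ((n ∸ 1) ^ (j * 2)) % n ≡ 1 % n
[n∸1]^[j*2]≡1 {n} j = begin
  (x ^ (j * 2)) % n     ≡⟨ cong (λ e → (x ^ e) % n) (*-comm j 2) ⟩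
  (x ^ (2 * j)) % n     ≡⟨ cong (_% n) (^-*-assoc x 2 j) ⟨
  ((x ^ 2) ^ j) % n     ≡⟨ cong (λ y → (y ^ j) % n) (cong (x *_) (*-identityʳ x)) ⟩
  ((x * x) ^ j) % n     ≡⟨ %-cong-^ n j [n∸1]²≡1 ⟩
  (1 ^ j) % n           ≡⟨ cong (_% n) (^-zeroˡ j) ⟩
  1 % n                 ∎
  where
  open ≡-Reasoning
  x : ℕ
  x = n ∸ 1

module _ {n : ℕ} (2<n : 2 < n) (half : IsExponent n ((n ∸ 1) / 2)) where

  private
    instance
      n≢0 : NonZero n
      n≢0 = >-nonZero (<-trans z<s 2<n)

    e : ℕ
    e = (n ∸ 1) / 2

    half% : ∀ {a} → Coprime a n → (a ^ e) % n ≡ 1 % n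
    half% = IsExponent⇒^% e half

  -- A liar with symbol −1 would give n ∣ a^e + 1 ≡ 2.
  eulerLiar⇒jacobiPlus : ∀ {a} → IsEulerLiar n a → IsJacobiPlus n a
  eulerLiar⇒jacobiPlus {a} ((_ , coprime[a]) , jacobi≡a^e) with jacobiFuel-±1 n coprime[a]
  ... | inj₁ plus  = coprime[a] , plus
  ... | inj₂ minus = contradiction (begin
    0                 ≡⟨ n∣m⇒m%n≡0 _ n n∣1+a^e ⟨
    (1 + a ^ e) % n   ≡⟨ %-cong-+ n {1} {1} refl (half% coprime[a]) ⟩
    2 % n             ≡⟨ m<n⇒m%n≡m 2<n ⟩
    2                 ∎) λ ()
    where
    open ≡-Reasoning
    n∣1+a^e : n ∣ 1 + a ^ e
    n∣1+a^e = subst (n ∣_) (∣-1-+n∣≡1+n (a ^ e))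
      (subst (λ j → j ≡ (+ (a ^ e)) [mod n ]) minus jacobi≡a^e)

  jacobiPlus⇒eulerLiar : ∀ {a} → a < n → IsJacobiPlus n a → IsEulerLiar n a
  jacobiPlus⇒eulerLiar {a} a<n (coprime[a] , plus) = (a<n , coprime[a]) ,
    subst (λ j → j ≡ (+ (a ^ e)) [mod n ]) (sym plus) (%≡⇒[mod] (sym (half% coprime[a])))

  length-eulerLiars≡count-jacobiPlus : length (eulerLiars n) ≡ count n (isJacobiPlus? n)
  length-eulerLiars≡count-jacobiPlus = trans (length-filter-upTo (isEulerLiar? n) n)
    (count-cong (isEulerLiar? n) (isJacobiPlus? n)
      (λ _ _ → eulerLiar⇒jacobiPlus) (λ _ → jacobiPlus⇒eulerLiar))

module _ {n : ℕ} (carmichael : IsCarmichael n) where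

  private
    fermat : IsExponent n (n ∸ 1)
    fermat = proj₂ carmichael

  2<n : 2 < n
  2<n with proj₁ carmichael
  ... | hasNonTrivialDivisor {suc (suc _)} d<n _ = ≤-trans (s≤s (s≤s (s≤s z≤n))) d<n

  private instance
    n≢0 : NonZero n
    n≢0 = >-nonZero (<-trans z<s 2<n)

  -- Otherwise n − 1 ≡ −1 would be a unit with (−1)^(n−1) ≡ −1.
  carmichael-odd : ¬ 2 ∣ n
  carmichael-odd (divides zero n≡0) = contradiction n≡0 (≢-nonZero⁻¹ n)
  carmichael-odd (divides (suc j) n≡[1+j]*2) = contradiction n≡2 (<⇒≢ 2<n ∘ sym)
    where
    open ≡-Reasoning
    x : ℕ
    x = n ∸ 1

    coprime[x] : Coprime x n
    coprime[x] {e} (e∣x , e∣n) = ∣1⇒≡1 (∣m+n∣m⇒∣n (subst (e ∣_) (sym n∸1+1≡n) e∣n) e∣x)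

    x≡1 : x ≡ 1
    x≡1 = begin
      x                         ≡⟨ m<n⇒m%n≡m (subst (x <_) n∸1+1≡n (m<m+n x z<s)) ⟨
      x % n                     ≡⟨ cong (_% n) (*-identityʳ x) ⟨
      (x * 1) % n               ≡⟨ %-congʳ-* n x ([n∸1]^[j*2]≡1 j) ⟨
      (x * x ^ (j * 2)) % n     ≡⟨ cong (λ e → (x ^ e) % n) (cong (_∸ 1) n≡[1+j]*2) ⟨
      (x ^ x) % n               ≡⟨ IsExponent⇒^% x fermat coprime[x] ⟩
      1 % n                     ≡⟨ m<n⇒m%n≡m (<-trans (s≤s z<s) 2<n) ⟩
      1                         ∎

    n≡2 : n ≡ 2
    n≡2 = trans (sym n∸1+1≡n) (cong (λ y → y + 1) x≡1)

  halfExponent : HasEvenIndex n → IsExponent n ((n ∸ 1) / 2)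
  halfExponent evenIndex with ∃carmichaelLambda 0<n∸1 fermat
    where
    0<n∸1 : 0 < n ∸ 1
    0<n∸1 = m<n⇒0<n∸m (<-trans (s≤s z<s) 2<n)
  ... | ℓ , isLambda with carmichaelLambda∣ isLambda fermat
  ... | divides i n∸1≡iℓ with evenIndex ℓ i isLambda (sym n∸1≡iℓ)
  ... | divides j i≡j*2 =
    subst (IsExponent n) (sym [n∸1]/2≡ℓj) (IsExponent-*ʳ ℓ j (proj₁ (proj₂ isLambda)))
    where
    open ≡-Reasoning
    regroup : ∀ j ℓ → j * 2 * ℓ ≡ ℓ * j * 2
    regroup = solve-∀
    [n∸1]/2≡ℓj : (n ∸ 1) / 2 ≡ ℓ * j
    [n∸1]/2≡ℓj = begin
      (n ∸ 1) / 2       ≡⟨ cong (_/ 2) n∸1≡iℓ ⟩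
      (i * ℓ) / 2       ≡⟨ cong (λ i → (i * ℓ) / 2) i≡j*2 ⟩
      (j * 2 * ℓ) / 2   ≡⟨ cong (_/ 2) (regroup j ℓ) ⟩
      (ℓ * j * 2) / 2   ≡⟨ m*n/n≡m (ℓ * j) 2 ⟩
      ℓ * j             ∎

  private
    q n/q : ℕ
    q   = leastDivisor n
    n/q = n / q

    2≤n : 2 ≤ n
    2≤n = <⇒≤ 2<n

    q-prime : Prime q
    q-prime = leastDivisor-prime 2≤n

    q*[n/q]≡n : q * n/q ≡ n
    q*[n/q]≡n = m*[n/m]≡n (leastDivisor-∣ 2≤n)

    instance
      n/q≢0 : NonZero n/q
      n/q≢0 = m/leastDivisor[m]≢0 2≤n

    q∤n/q : ¬ q ∣ n/q
    q∤n/q (divides t n/q≡tq) = contradiction (∣⇒≤ n∣n/q) (<⇒≱ (m/n<m n q (s≤s z<s)))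
      where
      n∣n/q : n ∣ n/q
      n∣n/q = IsExponent[n∸1]⇒squarefree fermat (divides t (begin
        n/q * n/q     ≡⟨ cong (_* n/q) n/q≡tq ⟩
        t * q * n/q   ≡⟨ *-assoc t q n/q ⟩
        t * (q * n/q) ≡⟨ cong (t *_) q*[n/q]≡n ⟩
        t * n         ∎))
        where open ≡-Reasoning

    1<n/q : 1 < n/q
    1<n/q with n/q ≟ 1
    ... | no n/q≢1 = ≤∧≢⇒< (>-nonZero⁻¹ n/q) (n/q≢1 ∘ sym)
    ... | yes n/q≡1 = contradiction (subst Prime q≡n q-prime) (composite⇒¬prime (proj₁ carmichael))
      where
      q≡n : q ≡ n
      q≡n = trans (sym (*-identityʳ q)) (trans (cong (q *_) (sym n/q≡1)) q*[n/q]≡n)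

    coprime[q,n/q] : Coprime q n/q
    coprime[q,n/q] (e∣q , e∣n/q) with prime⇒irreducible q-prime e∣q
    ... | inj₁ e≡1  = e≡1
    ... | inj₂ refl = contradiction e∣n/q q∤n/q

  -- b ≡ c (mod q) for a quadratic nonresidue c, and b ≡ 1 (mod n/q).
  ∃jacobi-flip : ∃[ b ] Coprime b n × ∀ {a} → Coprime a n → jacobi ((b * a) % n) n ≡ ℤ.- jacobi a n
  ∃jacobi-flip =
    let c , q∤c , legendre-flip = ∃-legendre-flip q-prime q-odd
        b , b≡c , b≡1 = chineseRemainder (s≤s z<s) 1<n/q coprime[q,n/q] c 1
    in b , subst (Coprime b) q*[n/q]≡n
             (coprime-*ʳ (coprime-resp-% (sym b≡c) (∤⇒coprime q-prime q∤c))
                         (coprime-resp-% (sym b≡1) (1-coprimeTo n/q)))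
         , jacobi-*-flip 2≤n {b} {c} legendre-flip b≡c b≡1
    where
    q-odd : ¬ 2 ∣ q
    q-odd 2∣q = carmichael-odd (∣-trans 2∣q (leastDivisor-∣ 2≤n))

  φ≡count-jacobiPlus*2 : φ n ≡ count n (isJacobiPlus? n) * 2
  φ≡count-jacobiPlus*2 = begin
    φ n             ≡⟨ φ≡count-jacobiPlus+count-jacobiMinus n ⟩
    plus + minus    ≡⟨ cong (λ m → plus + m) minus≡plus ⟩
    plus + plus     ≡⟨ cong (λ m → plus + m) (*-identityʳ plus) ⟨
    plus + plus * 1 ≡⟨ *-suc plus 1 ⟨
    plus * 2        ∎
    where
    open ≡-Reasoning
    plus minus : ℕ
    plus  = count n (isJacobiPlus? n)
    minus = count n (isJacobiMinus? n)
    minus≡plus : minus ≡ plus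
    minus≡plus = let b , coprime[b] , flip = ∃jacobi-flip
                 in count-jacobiMinus≡count-jacobiPlus (<-trans (s≤s z<s) 2<n) coprime[b] flip

mainTheorem1 : (n : ℕ) → IsCarmichael n →
    (∀ ℓ i → IsCarmichaelLambda n ℓ → i * ℓ ≡ n ∸ 1 → 2 ∣ i) →
    (length (eulerLiars n) ≡ φ n / 2)
      × (∀ a → IsEulerLiar n a → jacobi a n ≡ + 1)
mainTheorem1 n carmichael evenIndex =
  length≡φ/2 , λ _ → proj₂ ∘ eulerLiar⇒jacobiPlus (2<n carmichael) half
  where
  open ≡-Reasoning
  half : IsExponent n ((n ∸ 1) / 2)
  half = halfExponent carmichael evenIndex
  length≡φ/2 : length (eulerLiars n) ≡ φ n / 2
  length≡φ/2 = begin
    length (eulerLiars n)             ≡⟨ length-eulerLiars≡count-jacobiPlus (2<n carmichael) half ⟩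
    count n (isJacobiPlus? n)         ≡⟨ m*n/n≡m _ 2 ⟨
    count n (isJacobiPlus? n) * 2 / 2 ≡⟨ cong (_/ 2) (φ≡count-jacobiPlus*2 carmichael) ⟨
    φ n / 2                           ∎
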